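{- Let $h\ge 0$ and $k=2^h$. Then for every integer $n$ with $2^h\le n<2^{h+1}$, \[ \nu_2(s(n,k))=h-\sigma_2(n-1). \]
   Context: $s(n,k)$ is the signed Stirling number of the first kind, defined by $x(x-1)\cdots(x-n+1)=\sum_k s(n,k)x^k$. $\nu_2$ is the $2$-adic valuation and $\sigma_2(m)$ is the number of ones in the binary representation of $m$. -}

module Defs where

open import Data.Nat as ℕ using (ℕ; zero; suc; _/_; _%_; _^_; _∸_)
open import Data.Integer as ℤ using (ℤ; +_; _-_; _*_)
open import Data.Integer.Divisibility using (_∣_)
open import Relation.Nullary using (¬_)
open import Data.Product using (_×_)

-- Signed Stirling numbers of the first kind:
-- x(x-1)...(x-n+1) = Σ_k s(n,k) x^k, via the standard recurrence
-- s(n+1,k) = s(n,k-1) - n s(n,k),  s(0,0)=1, s(0,k+1)=0, s(n+1,0)=0.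
stirling1 : ℕ → ℕ → ℤ
stirling1 zero    zero    = + 1
stirling1 zero    (suc k) = + 0
stirling1 (suc n) zero    = + 0
stirling1 (suc n) (suc k) = stirling1 n k - (+ n) * stirling1 n (suc k)

-- number of ones in binary representation (fuel-based; fuel m suffices for m)
popcountAux : ℕ → ℕ → ℕ
popcountAux zero    m = 0
popcountAux (suc f) zero = 0
popcountAux (suc f) m@(suc _) = m % 2 ℕ.+ popcountAux f (m / 2)

σ₂ : ℕ → ℕ
σ₂ m = popcountAux m m

ν₂≡ : ℤ → ℕ → Set
ν₂≡ z v = ((+ (2 ^ v)) ∣ z) × ¬ ((+ (2 ^ suc v)) ∣ z)

-- Write K = 2^h and n = K + m with m < K.  The heart of the proof is the
-- 2-adic congruence, in ℤ_(2),
--   (⋆)  2^i · K! · s(K+i, K)  ≡  C(K,i) · (K+i)!   mod 2^(h+1) · (K+i)!   for all i,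
-- proved by induction on h.  For K = 1 it follows from s(i+1,1) = (−1)^i i!.
-- The step K ↦ 2K rests on the convolution identity (the product of the
-- exponential generating functions log(1+x)^j/j! and log(1+x)^l/l!)
--   Σ_{a+b=N} C(a+b,a) s(a,j) s(b,l) = C(j+l,j) s(N,j+l)
-- and on Vandermonde's identity: together they express both sides of (⋆) for 2K
-- as convolutions of the corresponding sides for K, and the difference
-- factors so that it gains one more power of 2.
-- Since ν₂(C(K,m)) = h − ν₂(m) ≤ h, (⋆) pins down ν₂(2^m K! s(K+m,K)) as
-- ν₂(C(K,m)) + ν₂((K+m)!), and Legendre's formula ν₂(m!) = m − σ₂(m), the
-- carry rule σ₂(m) + ν₂(m) = σ₂(m−1) + 1 and σ₂(K+m) = 1 + σ₂(m) turn this
-- into the stated formula.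
module Submission where

open import Defs
open import Data.Nat using (ℕ; _≤_; _<_; _^_; _∸_; suc)
open import Data.Product using (_×_)

open import Data.Nat using (zero; _+_; _*_; _!; z≤n; s≤s; _%_; _/_; ≢-nonZero)
import Data.Nat.Properties as ℕP
import Data.Nat.Tactic.RingSolver as ℕSolver
open import Data.Nat.Combinatorics using (_C_; nCn≡1; nC1≡n; nCk≡nC[n∸k]; k>n⇒nCk≡0; nCk+nC[k+1]≡[n+1]C[k+1])
open import Data.Integer using (ℤ; +_; -[1+_]; ∣_∣) renaming (_+_ to _+ℤ_; _*_ to _*ℤ_; _-_ to _-ℤ_; -_ to -ℤ_)
import Data.Integer.Properties as ℤP
open import Data.Integer.Tactic.RingSolver using (solve-∀)
open import Data.Product using (Σ; _,_; proj₁; proj₂)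
open import Data.Sum using (_⊎_; inj₁; inj₂)
open import Data.Empty using (⊥-elim)
open import Relation.Nullary using (¬_)
open import Relation.Binary.PropositionalEquality
import Data.Nat.Divisibility as ℕDiv
import Data.Nat.DivMod as ℕDivMod
open import Data.Nat.Induction using (<-rec)

-- Convolution sums: conv n g = Σ_{a+b=n} g a b.

conv : ℕ → (ℕ → ℕ → ℤ) → ℤ
conv zero    g = g 0 0
conv (suc n) g = g 0 (suc n) +ℤ conv n (λ a b → g (suc a) b)

conv-cong : ∀ n {g g′ : ℕ → ℕ → ℤ} → (∀ a b → a + b ≡ n → g a b ≡ g′ a b) → conv n g ≡ conv n g′
conv-cong zero    g≡g′ = g≡g′ 0 0 refl
conv-cong (suc n) g≡g′ = cong₂ _+ℤ_ (g≡g′ 0 (suc n) refl) (conv-cong n (λ a b e → g≡g′ (suc a) b (cong suc e)))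

conv-zero : ∀ n → conv n (λ _ _ → + 0) ≡ + 0
conv-zero zero    = refl
conv-zero (suc n) = cong (+ 0 +ℤ_) (conv-zero n)

conv-+ : ∀ n (g g′ : ℕ → ℕ → ℤ) → conv n (λ a b → g a b +ℤ g′ a b) ≡ conv n g +ℤ conv n g′
conv-+ zero    g g′ = refl
conv-+ (suc n) g g′ =
  trans (cong (g 0 (suc n) +ℤ g′ 0 (suc n) +ℤ_) (conv-+ n (λ a b → g (suc a) b) (λ a b → g′ (suc a) b)))
        (interchange (g 0 (suc n)) (g′ 0 (suc n)) _ _)
  where
  interchange : ∀ (x y u v : ℤ) → x +ℤ y +ℤ (u +ℤ v) ≡ x +ℤ u +ℤ (y +ℤ v)
  interchange = solve-∀

conv-- : ∀ n (g g′ : ℕ → ℕ → ℤ) → conv n (λ a b → g a b -ℤ g′ a b) ≡ conv n g -ℤ conv n g′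
conv-- zero    g g′ = refl
conv-- (suc n) g g′ =
  trans (cong ((g 0 (suc n) -ℤ g′ 0 (suc n)) +ℤ_) (conv-- n (λ a b → g (suc a) b) (λ a b → g′ (suc a) b)))
        (interchange (g 0 (suc n)) (g′ 0 (suc n)) _ _)
  where
  interchange : ∀ (x y u v : ℤ) → (x -ℤ y) +ℤ (u -ℤ v) ≡ (x +ℤ u) -ℤ (y +ℤ v)
  interchange = solve-∀

conv-*ˡ : ∀ n (c : ℤ) (g : ℕ → ℕ → ℤ) → conv n (λ a b → c *ℤ g a b) ≡ c *ℤ conv n g
conv-*ˡ zero    c g = refl
conv-*ˡ (suc n) c g = trans (cong (c *ℤ g 0 (suc n) +ℤ_) (conv-*ˡ n c _)) (sym (ℤP.*-distribˡ-+ c _ _))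

conv-last : ∀ n (g : ℕ → ℕ → ℤ) → conv (suc n) g ≡ conv n (λ a b → g a (suc b)) +ℤ g (suc n) 0
conv-last zero    g = refl
conv-last (suc n) g = trans (cong (g 0 (suc (suc n)) +ℤ_) (conv-last n (λ a b → g (suc a) b)))
                            (sym (ℤP.+-assoc (g 0 (suc (suc n))) _ _))

conv-swap : ∀ n (g : ℕ → ℕ → ℤ) → conv n g ≡ conv n (λ a b → g b a)
conv-swap zero    g = refl
conv-swap (suc n) g = begin
    g 0 (suc n) +ℤ conv n (λ a b → g (suc a) b)  ≡⟨ cong (g 0 (suc n) +ℤ_) (conv-swap n (λ a b → g (suc a) b)) ⟩
    g 0 (suc n) +ℤ conv n (λ a b → g (suc b) a)  ≡⟨ ℤP.+-comm (g 0 (suc n)) _ ⟩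
    conv n (λ a b → g (suc b) a) +ℤ g 0 (suc n)  ≡⟨ conv-last n (λ a b → g b a) ⟨
    conv (suc n) (λ a b → g b a)                 ∎
  where open ≡-Reasoning

conv-first : ∀ n (g : ℕ → ℕ → ℤ) → (∀ a b → g (suc a) b ≡ + 0) → conv n g ≡ g 0 n
conv-first zero    g g₊≡0 = refl
conv-first (suc n) g g₊≡0 =
  trans (cong (g 0 (suc n) +ℤ_) (trans (conv-cong n (λ a b _ → g₊≡0 a b)) (conv-zero n))) (ℤP.+-identityʳ _)

conv-dropˡ : ∀ k n (g : ℕ → ℕ → ℤ) → (∀ a b → a < k → g a b ≡ + 0) →
  conv (k + n) g ≡ conv n (λ a b → g (k + a) b)
conv-dropˡ zero    n g g<≡0 = refl
conv-dropˡ (suc k) n g g<≡0 =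
  trans (cong (_+ℤ conv (k + n) (λ a b → g (suc a) b)) (g<≡0 0 _ (s≤s z≤n)))
        (trans (ℤP.+-identityˡ _) (conv-dropˡ k n (λ a b → g (suc a) b) (λ a b a<k → g<≡0 (suc a) b (s≤s a<k))))

conv-dropʳ : ∀ k n (g : ℕ → ℕ → ℤ) → (∀ a b → b < k → g a b ≡ + 0) →
  conv (n + k) g ≡ conv n (λ a b → g a (k + b))
conv-dropʳ k n g g<≡0 = begin
    conv (n + k) g                    ≡⟨ cong (λ t → conv t g) (ℕP.+-comm n k) ⟩
    conv (k + n) g                    ≡⟨ conv-swap (k + n) g ⟩
    conv (k + n) (λ a b → g b a)      ≡⟨ conv-dropˡ k n (λ a b → g b a) (λ a b → g<≡0 b a) ⟩
    conv n (λ a b → g b (k + a))      ≡⟨ conv-swap n (λ a b → g b (k + a)) ⟩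
    conv n (λ a b → g a (k + b))      ∎
  where open ≡-Reasoning

-- For a symmetric weight c, the cross terms of (x_i − y_i)(x_j + y_j) cancel:
--   Σ c_ij (x_i x_j − y_i y_j) = Σ c_ij (x_i − y_i)(x_j + y_j).
conv-difference-of-squares : ∀ m (c : ℕ → ℕ → ℤ) (x y : ℕ → ℤ) → (∀ i j → c i j ≡ c j i) →
  conv m (λ i j → c i j *ℤ (x i *ℤ x j) -ℤ c i j *ℤ (y i *ℤ y j)) ≡ conv m (λ i j → c i j *ℤ ((x i -ℤ y i) *ℤ (x j +ℤ y j)))
conv-difference-of-squares m c x y c-sym = begin
    conv m Sq
  ≡⟨ ℤP.+-identityʳ (conv m Sq) ⟨
    conv m Sq +ℤ + 0
  ≡⟨ cong (conv m Sq +ℤ_) (trans (sym (ℤP.+-inverseʳ (conv m Cross′))) (cong (_-ℤ conv m Cross′) (sym cross-swap))) ⟩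
    conv m Sq +ℤ (conv m Cross -ℤ conv m Cross′)
  ≡⟨ cong (conv m Sq +ℤ_) (conv-- m Cross Cross′) ⟨
    conv m Sq +ℤ conv m (λ i j → Cross i j -ℤ Cross′ i j)
  ≡⟨ conv-+ m Sq (λ i j → Cross i j -ℤ Cross′ i j) ⟨
    conv m (λ i j → Sq i j +ℤ (Cross i j -ℤ Cross′ i j))
  ≡⟨ conv-cong m (λ i j _ → expand (c i j) (x i) (y i) (x j) (y j)) ⟩
    conv m (λ i j → c i j *ℤ ((x i -ℤ y i) *ℤ (x j +ℤ y j))) ∎
  where
  open ≡-Reasoning
  Sq Cross Cross′ : ℕ → ℕ → ℤ
  Sq     i j = c i j *ℤ (x i *ℤ x j) -ℤ c i j *ℤ (y i *ℤ y j)
  Cross  i j = c i j *ℤ (x i *ℤ y j)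
  Cross′ i j = c i j *ℤ (y i *ℤ x j)
  cross-swap : conv m Cross ≡ conv m Cross′
  cross-swap = trans (conv-swap m Cross) (conv-cong m (λ i j _ → cong₂ _*ℤ_ (c-sym j i) (ℤP.*-comm (x j) (y i))))
  expand : ∀ c a b u v → (c *ℤ (a *ℤ u) -ℤ c *ℤ (b *ℤ v)) +ℤ (c *ℤ (a *ℤ v) -ℤ c *ℤ (b *ℤ u)) ≡ c *ℤ ((a -ℤ b) *ℤ (u +ℤ v))
  expand = solve-∀

C-zeroʳ : ∀ n → n C 0 ≡ 1
C-zeroʳ n = trans (nCk≡nC[n∸k] {n = n} z≤n) (nCn≡1 n)

C-zeroˡ : ∀ k → 0 C suc k ≡ 0
C-zeroˡ k = k>n⇒nCk≡0 {n = 0} {k = suc k} (s≤s z≤n)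

C-pascal : ∀ n k → suc n C suc k ≡ n C k + n C suc k
C-pascal n k = sym (nCk+nC[k+1]≡[n+1]C[k+1] n k)

C-absorb : ∀ n j → suc j * (suc n C suc j) ≡ suc n * (n C j)
C-absorb zero    zero    = refl
C-absorb zero    (suc j) = trans (cong (suc (suc j) *_) (k>n⇒nCk≡0 {n = 1} {k = suc (suc j)} (s≤s (s≤s z≤n)))) (ℕP.*-zeroʳ (suc (suc j)))
C-absorb (suc n) zero    = trans (ℕP.*-identityˡ _) (trans (nC1≡n (suc (suc n)))
                                 (sym (trans (cong (suc (suc n) *_) (C-zeroʳ (suc n))) (ℕP.*-identityʳ _))))
C-absorb (suc n) (suc j) = begin
    suc (suc j) * (suc (suc n) C suc (suc j))
  ≡⟨ cong (suc (suc j) *_) (C-pascal (suc n) (suc j)) ⟩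
    suc (suc j) * (suc n C suc j + suc n C suc (suc j))
  ≡⟨ split (suc j) (suc n C suc j) (suc n C suc (suc j)) ⟩
    suc j * (suc n C suc j) + suc n C suc j + suc (suc j) * (suc n C suc (suc j))
  ≡⟨ cong₂ (λ x y → x + suc n C suc j + y) (C-absorb n j) (C-absorb n (suc j)) ⟩
    suc n * (n C j) + suc n C suc j + suc n * (n C suc j)
  ≡⟨ cong (λ x → suc n * (n C j) + x + suc n * (n C suc j)) (C-pascal n j) ⟩
    suc n * (n C j) + (n C j + n C suc j) + suc n * (n C suc j)
  ≡⟨ merge (suc n) (n C j) (n C suc j) ⟩
    suc (suc n) * (n C j + n C suc j)
  ≡⟨ cong (suc (suc n) *_) (C-pascal n j) ⟨
    suc (suc n) * (suc n C suc j) ∎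
  where
  open ≡-Reasoning
  split : ∀ x p q → suc x * (p + q) ≡ x * p + p + suc x * q
  split = ℕSolver.solve-∀
  merge : ∀ m p q → m * p + (p + q) + m * q ≡ suc m * (p + q)
  merge = ℕSolver.solve-∀

vandermonde : ∀ x y m → + ((x + y) C m) ≡ conv m (λ i j → + ((x C i) * (y C j)))
vandermonde zero    y m = sym (trans (conv-first m (λ i j → + ((0 C i) * (y C j))) (λ i j → cong (λ c → + (c * (y C j))) (C-zeroˡ i)))
                                     (cong +_ (trans (cong (_* (y C m)) (C-zeroʳ 0)) (ℕP.*-identityˡ _))))
vandermonde (suc x) y zero = cong +_ (trans (C-zeroʳ (suc (x + y))) (sym (cong₂ _*_ (C-zeroʳ (suc x)) (C-zeroʳ y))))
vandermonde (suc x) y (suc m) = begin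
    + (suc (x + y) C suc m)
  ≡⟨ cong +_ (C-pascal (x + y) m) ⟩
    + ((x + y) C m + (x + y) C suc m)
  ≡⟨ ℤP.pos-+ ((x + y) C m) _ ⟩
    + ((x + y) C m) +ℤ + ((x + y) C suc m)
  ≡⟨ cong₂ _+ℤ_ (vandermonde x y m) (vandermonde x y (suc m)) ⟩
    conv m G +ℤ conv (suc m) G
  ≡⟨ cong (_+ℤ conv (suc m) G) (ℤP.+-identityˡ (conv m G)) ⟨
    conv (suc m) G⁻ +ℤ conv (suc m) G
  ≡⟨ conv-+ (suc m) G⁻ G ⟨
    conv (suc m) (λ i j → G⁻ i j +ℤ G i j)
  ≡⟨ conv-cong (suc m) (λ i j _ → pascal i j) ⟩
    conv (suc m) (λ i j → + ((suc x C i) * (y C j))) ∎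
  where
  open ≡-Reasoning
  G G⁻ : ℕ → ℕ → ℤ
  G i j = + ((x C i) * (y C j))
  G⁻ zero    j = + 0
  G⁻ (suc i) j = G i j
  pascal : ∀ i j → G⁻ i j +ℤ G i j ≡ + ((suc x C i) * (y C j))
  pascal zero    j = trans (ℤP.+-identityˡ _) (cong (λ c → + (c * (y C j))) (trans (C-zeroʳ x) (sym (C-zeroʳ (suc x)))))
  pascal (suc i) j = trans (sym (ℤP.pos-+ ((x C i) * (y C j)) _))
                           (cong +_ (trans (sym (ℕP.*-distribʳ-+ (y C j) (x C i) _)) (cong (_* (y C j)) (sym (C-pascal x i)))))

B : ℕ → ℕ → ℕ
B a b = (a + b) C a

B-zeroˡ : ∀ b → B 0 b ≡ 1
B-zeroˡ b = C-zeroʳ b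

B-zeroʳ : ∀ a → B a 0 ≡ 1
B-zeroʳ a = trans (cong (_C a) (ℕP.+-identityʳ a)) (nCn≡1 a)

B-pascal : ∀ a b → B (suc a) (suc b) ≡ B a (suc b) + B (suc a) b
B-pascal a b = trans (C-pascal (a + suc b) a) (cong (λ t → B a (suc b) + t C suc a) (ℕP.+-suc a b))

B-sym : ∀ a b → B a b ≡ B b a
B-sym zero    zero    = refl
B-sym zero    (suc b) = trans (B-zeroˡ (suc b)) (sym (B-zeroʳ (suc b)))
B-sym (suc a) zero    = trans (B-zeroʳ (suc a)) (sym (B-zeroˡ (suc a)))
B-sym (suc a) (suc b) = begin
    B (suc a) (suc b)              ≡⟨ B-pascal a b ⟩
    B a (suc b) + B (suc a) b      ≡⟨ cong₂ _+_ (B-sym a (suc b)) (B-sym (suc a) b) ⟩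
    B (suc b) a + B b (suc a)      ≡⟨ ℕP.+-comm (B (suc b) a) _ ⟩
    B b (suc a) + B (suc b) a      ≡⟨ B-pascal b a ⟨
    B (suc b) (suc a)              ∎
  where open ≡-Reasoning

B-fac : ∀ a b → B a b * (a ! * b !) ≡ (a + b) !
B-fac zero    b = trans (cong (_* (1 * b !)) (B-zeroˡ b)) (trans (ℕP.*-identityˡ _) (ℕP.*-identityˡ _))
B-fac (suc a) zero = begin
    B (suc a) 0 * (suc a ! * 1)  ≡⟨ cong₂ _*_ (B-zeroʳ (suc a)) (ℕP.*-identityʳ _) ⟩
    1 * suc a !                  ≡⟨ ℕP.*-identityˡ _ ⟩
    suc a !                      ≡⟨ cong _! (ℕP.+-identityʳ (suc a)) ⟨
    (suc a + 0) !                ∎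
  where open ≡-Reasoning
B-fac (suc a) (suc b) = begin
    B (suc a) (suc b) * (suc a ! * suc b !)
  ≡⟨ cong (_* (suc a ! * suc b !)) (B-pascal a b) ⟩
    (B a (suc b) + B (suc a) b) * ((suc a * a !) * (suc b * b !))
  ≡⟨ distribute (B a (suc b)) (B (suc a) b) a (a !) b (b !) ⟩
    B a (suc b) * (a ! * suc b !) * suc a + B (suc a) b * (suc a ! * b !) * suc b
  ≡⟨ cong₂ (λ x y → x * suc a + y * suc b) (B-fac a (suc b)) (B-fac (suc a) b) ⟩
    (a + suc b) ! * suc a + (suc a + b) ! * suc b
  ≡⟨ cong (λ x → x ! * suc a + (suc a + b) ! * suc b) (ℕP.+-suc a b) ⟩
    (suc a + b) ! * suc a + (suc a + b) ! * suc b
  ≡⟨ collect ((suc a + b) !) a b ⟩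
    suc (suc (a + b)) * (suc a + b) !
  ≡⟨ cong (λ x → suc x !) (ℕP.+-suc a b) ⟨
    (suc a + suc b) ! ∎
  where
  open ≡-Reasoning
  distribute : ∀ p q a fa b fb → (p + q) * ((suc a * fa) * (suc b * fb)) ≡
    p * (fa * (suc b * fb)) * suc a + q * ((suc a * fa) * fb) * suc b
  distribute = ℕSolver.solve-∀
  collect : ∀ f a b → f * suc a + f * suc b ≡ suc (suc (a + b)) * f
  collect = ℕSolver.solve-∀

s : ℕ → ℕ → ℤ
s = stirling1

s⁻ : ℕ → ℕ → ℤ
s⁻ a zero    = + 0
s⁻ a (suc j) = s a j

s-rec : ∀ a j → s (suc a) j ≡ s⁻ a j -ℤ + a *ℤ s a j
s-rec zero    zero    = refl
s-rec (suc a) zero    = sym (cong (λ x → + 0 -ℤ x) (ℤP.*-zeroʳ (+ suc a)))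
s-rec a       (suc j) = refl

s-below : ∀ a k → a < k → s a k ≡ + 0
s-below zero    (suc k) _         = refl
s-below (suc a) (suc k) (s≤s a<k) = begin
    s a k -ℤ + a *ℤ s a (suc k)  ≡⟨ cong₂ (λ x y → x -ℤ + a *ℤ y) (s-below a k a<k) (s-below a (suc k) (ℕP.m<n⇒m<1+n a<k)) ⟩
    + 0 -ℤ + a *ℤ + 0            ≡⟨ cong (λ x → + 0 -ℤ x) (ℤP.*-zeroʳ (+ a)) ⟩
    + 0                          ∎
  where open ≡-Reasoning

s-diag : ∀ n → s n n ≡ + 1
s-diag zero    = refl
s-diag (suc n) = begin
    s n n -ℤ + n *ℤ s n (suc n)  ≡⟨ cong₂ (λ x y → x -ℤ + n *ℤ y) (s-diag n) (s-below n (suc n) ℕP.≤-refl) ⟩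
    + 1 -ℤ + n *ℤ + 0            ≡⟨ cong (λ x → + 1 -ℤ x) (ℤP.*-zeroʳ (+ n)) ⟩
    + 1                          ∎
  where open ≡-Reasoning

sign : ℕ → ℤ
sign zero    = + 1
sign (suc m) = -ℤ sign m

s-col1 : ∀ m → s (suc m) 1 ≡ sign m *ℤ + (m !)
s-col1 zero    = refl
s-col1 (suc m) = begin
    + 0 -ℤ + suc m *ℤ s (suc m) 1               ≡⟨ cong (λ x → + 0 -ℤ + suc m *ℤ x) (s-col1 m) ⟩
    + 0 -ℤ + suc m *ℤ (sign m *ℤ + (m !))         ≡⟨ regroup (+ suc m) (sign m) (+ (m !)) ⟩
    -ℤ sign m *ℤ (+ suc m *ℤ + (m !))             ≡⟨ cong (λ x → -ℤ sign m *ℤ x) (ℤP.pos-* (suc m) (m !)) ⟨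
    -ℤ sign m *ℤ + (suc m !)                      ∎
  where
  open ≡-Reasoning
  regroup : ∀ a b c → + 0 -ℤ a *ℤ (b *ℤ c) ≡ -ℤ b *ℤ (a *ℤ c)
  regroup = solve-∀

conv-pascal : ∀ N (f : ℕ → ℕ → ℤ) →
  conv (suc N) (λ a b → + B a b *ℤ f a b) ≡ conv N (λ a b → + B a b *ℤ (f (suc a) b +ℤ f a (suc b)))
conv-pascal N f = begin
    conv (suc N) (λ a b → + B a b *ℤ f a b)
  ≡⟨ conv-cong (suc N) split ⟩
    conv (suc N) (λ a b → F₁ a b +ℤ F₂ a b)
  ≡⟨ conv-+ (suc N) F₁ F₂ ⟩
    conv (suc N) F₁ +ℤ conv (suc N) F₂
  ≡⟨ cong₂ _+ℤ_ (ℤP.+-identityˡ (conv N (λ a b → + B a b *ℤ f (suc a) b)))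
                (trans (conv-last N F₂) (ℤP.+-identityʳ (conv N (λ a b → + B a b *ℤ f a (suc b))))) ⟩
    conv N (λ a b → + B a b *ℤ f (suc a) b) +ℤ conv N (λ a b → + B a b *ℤ f a (suc b))
  ≡⟨ conv-+ N (λ a b → + B a b *ℤ f (suc a) b) (λ a b → + B a b *ℤ f a (suc b)) ⟨
    conv N (λ a b → + B a b *ℤ f (suc a) b +ℤ + B a b *ℤ f a (suc b))
  ≡⟨ conv-cong N (λ a b _ → sym (ℤP.*-distribˡ-+ (+ B a b) _ _)) ⟩
    conv N (λ a b → + B a b *ℤ (f (suc a) b +ℤ f a (suc b))) ∎
  where
  open ≡-Reasoning
  F₁ F₂ : ℕ → ℕ → ℤ
  F₁ zero    b = + 0
  F₁ (suc a) b = + B a b *ℤ f (suc a) b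
  F₂ a zero    = + 0
  F₂ a (suc b) = + B a b *ℤ f a (suc b)
  split : ∀ a b → a + b ≡ suc N → + B a b *ℤ f a b ≡ F₁ a b +ℤ F₂ a b
  split zero    zero    ()
  split zero    (suc b) _ = sym (ℤP.+-identityˡ _)
  split (suc a) zero    _ = trans (cong (λ x → + x *ℤ f (suc a) 0) (trans (B-zeroʳ (suc a)) (sym (B-zeroʳ a)))) (sym (ℤP.+-identityʳ _))
  split (suc a) (suc b) _ = trans (cong (λ x → + x *ℤ f (suc a) (suc b)) (B-pascal a b))
                            (trans (cong (_*ℤ f (suc a) (suc b)) (ℤP.pos-+ (B a (suc b)) (B (suc a) b)))
                                   (ℤP.*-distribʳ-+ (f (suc a) (suc b)) (+ B a (suc b)) (+ B (suc a) b)))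

R : ℕ → ℕ → ℕ → ℤ
R j l N = conv N (λ a b → + B a b *ℤ (s a j *ℤ s b l))

-- The Stirling recurrence applied in both factors: R(N+1) splits into two
-- sums with one index lowered, plus −N · R(N).
R-split : ∀ N j l → R j l (suc N) ≡
  (conv N (λ a b → + B a b *ℤ (s⁻ a j *ℤ s b l)) +ℤ conv N (λ a b → + B a b *ℤ (s a j *ℤ s⁻ b l)))
    +ℤ (-ℤ + N) *ℤ R j l N
R-split N j l = begin
    R j l (suc N)
  ≡⟨ conv-pascal N (λ a b → s a j *ℤ s b l) ⟩
    conv N (λ a b → + B a b *ℤ (s (suc a) j *ℤ s b l +ℤ s a j *ℤ s (suc b) l))
  ≡⟨ conv-cong N recurrence ⟩
    conv N (λ a b → (X₁ a b +ℤ X₂ a b) +ℤ (-ℤ + N) *ℤ X a b)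
  ≡⟨ conv-+ N (λ a b → X₁ a b +ℤ X₂ a b) (λ a b → (-ℤ + N) *ℤ X a b) ⟩
    conv N (λ a b → X₁ a b +ℤ X₂ a b) +ℤ conv N (λ a b → (-ℤ + N) *ℤ X a b)
  ≡⟨ cong₂ _+ℤ_ (conv-+ N X₁ X₂) (conv-*ˡ N (-ℤ + N) X) ⟩
    (conv N X₁ +ℤ conv N X₂) +ℤ (-ℤ + N) *ℤ R j l N ∎
  where
  open ≡-Reasoning
  X₁ X₂ X : ℕ → ℕ → ℤ
  X₁ a b = + B a b *ℤ (s⁻ a j *ℤ s b l)
  X₂ a b = + B a b *ℤ (s a j *ℤ s⁻ b l)
  X  a b = + B a b *ℤ (s a j *ℤ s b l)
  expand : ∀ c u x y v p q →
    c *ℤ ((u -ℤ p *ℤ x) *ℤ y +ℤ x *ℤ (v -ℤ q *ℤ y)) ≡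
    (c *ℤ (u *ℤ y) +ℤ c *ℤ (x *ℤ v)) +ℤ (-ℤ (p +ℤ q)) *ℤ (c *ℤ (x *ℤ y))
  expand = solve-∀
  recurrence : ∀ a b → a + b ≡ N →
    + B a b *ℤ (s (suc a) j *ℤ s b l +ℤ s a j *ℤ s (suc b) l) ≡ (X₁ a b +ℤ X₂ a b) +ℤ (-ℤ + N) *ℤ X a b
  recurrence a b a+b≡N = begin
      + B a b *ℤ (s (suc a) j *ℤ s b l +ℤ s a j *ℤ s (suc b) l)
    ≡⟨ cong₂ (λ x y → + B a b *ℤ (x *ℤ s b l +ℤ s a j *ℤ y)) (s-rec a j) (s-rec b l) ⟩
      + B a b *ℤ ((s⁻ a j -ℤ + a *ℤ s a j) *ℤ s b l +ℤ s a j *ℤ (s⁻ b l -ℤ + b *ℤ s b l))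
    ≡⟨ expand (+ B a b) (s⁻ a j) (s a j) (s b l) (s⁻ b l) (+ a) (+ b) ⟩
      (X₁ a b +ℤ X₂ a b) +ℤ (-ℤ (+ a +ℤ + b)) *ℤ X a b
    ≡⟨ cong (λ x → (X₁ a b +ℤ X₂ a b) +ℤ (-ℤ x) *ℤ X a b) (trans (sym (ℤP.pos-+ a b)) (cong +_ a+b≡N)) ⟩
      (X₁ a b +ℤ X₂ a b) +ℤ (-ℤ + N) *ℤ X a b ∎

-- Bˡ j l = C(j+l−1, j−1) and Bʳ j l = C(j+l−1, j), the two Pascal parts of
-- B j l (both 0 when the lowered index would be negative).
Bˡ Bʳ : ℕ → ℕ → ℕ
Bˡ zero    l = 0
Bˡ (suc j) l = B j l
Bʳ j zero    = 0
Bʳ j (suc l) = B j l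

-- Pascal's rule B j l = Bˡ j l + Bʳ j l, which fails only for j = l = 0,
-- where the factor s(N, −1) vanishes.
B-split : ∀ N j l → + (Bˡ j l + Bʳ j l) *ℤ s⁻ N (j + l) ≡ + B j l *ℤ s⁻ N (j + l)
B-split N zero    zero    = trans (ℤP.*-zeroʳ (+ 0)) (sym (ℤP.*-zeroʳ (+ B 0 0)))
B-split N zero    (suc l) = refl
B-split N (suc j) zero    = cong (λ x → + x *ℤ s⁻ N (suc j + 0)) (trans (ℕP.+-identityʳ (B j 0))
                                   (trans (B-zeroʳ j) (sym (B-zeroʳ (suc j)))))
B-split N (suc j) (suc l) = cong (λ x → + x *ℤ s⁻ N (suc j + suc l)) (sym (B-pascal j l))

module _ (N : ℕ) (ih : ∀ j l → R j l N ≡ + B j l *ℤ s N (j + l)) where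

  lowered-left : ∀ j l → conv N (λ a b → + B a b *ℤ (s⁻ a j *ℤ s b l)) ≡ + Bˡ j l *ℤ s⁻ N (j + l)
  lowered-left zero    l = trans (conv-cong N (λ a b _ → ℤP.*-zeroʳ (+ B a b))) (conv-zero N)
  lowered-left (suc j) l = ih j l

  lowered-right : ∀ j l → conv N (λ a b → + B a b *ℤ (s a j *ℤ s⁻ b l)) ≡ + Bʳ j l *ℤ s⁻ N (j + l)
  lowered-right j zero    = trans (conv-cong N (λ a b _ → trans (cong (+ B a b *ℤ_) (ℤP.*-zeroʳ (s a j))) (ℤP.*-zeroʳ (+ B a b))))
                                  (trans (conv-zero N) (sym (ℤP.*-zeroˡ (s⁻ N (j + 0)))))
  lowered-right j (suc l) = trans (ih j l) (cong (λ t → + B j l *ℤ s⁻ N t) (sym (ℕP.+-suc j l)))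

stirling-convolution : ∀ N j l → R j l N ≡ + B j l *ℤ s N (j + l)
stirling-convolution zero    zero    zero    = refl
stirling-convolution zero    zero    (suc l) = refl
stirling-convolution zero    (suc j) l       = sym (ℤP.*-zeroʳ (+ B (suc j) l))
stirling-convolution (suc N) j l = begin
    R j l (suc N)
  ≡⟨ R-split N j l ⟩
    (conv N (λ a b → + B a b *ℤ (s⁻ a j *ℤ s b l)) +ℤ conv N (λ a b → + B a b *ℤ (s a j *ℤ s⁻ b l)))
      +ℤ (-ℤ + N) *ℤ R j l N
  ≡⟨ cong₂ (λ x y → x +ℤ (-ℤ + N) *ℤ y) (cong₂ _+ℤ_ (lowered-left N ih j l) (lowered-right N ih j l)) (ih j l) ⟩
    (+ Bˡ j l *ℤ s⁻ N (j + l) +ℤ + Bʳ j l *ℤ s⁻ N (j + l)) +ℤ (-ℤ + N) *ℤ (+ B j l *ℤ s N (j + l))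
  ≡⟨ cong (λ x → x +ℤ (-ℤ + N) *ℤ (+ B j l *ℤ s N (j + l)))
       (trans (sym (ℤP.*-distribʳ-+ (s⁻ N (j + l)) (+ Bˡ j l) (+ Bʳ j l)))
              (trans (cong (_*ℤ s⁻ N (j + l)) (sym (ℤP.pos-+ (Bˡ j l) (Bʳ j l)))) (B-split N j l))) ⟩
    + B j l *ℤ s⁻ N (j + l) +ℤ (-ℤ + N) *ℤ (+ B j l *ℤ s N (j + l))
  ≡⟨ factor (+ B j l) (s⁻ N (j + l)) (+ N) (s N (j + l)) ⟩
    + B j l *ℤ (s⁻ N (j + l) -ℤ + N *ℤ s N (j + l))
  ≡⟨ cong (+ B j l *ℤ_) (s-rec N (j + l)) ⟨
    + B j l *ℤ s (suc N) (j + l) ∎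
  where
  open ≡-Reasoning
  ih : ∀ j l → R j l N ≡ + B j l *ℤ s N (j + l)
  ih = stirling-convolution N
  factor : ∀ c u n v → c *ℤ u +ℤ (-ℤ n) *ℤ (c *ℤ v) ≡ c *ℤ (u -ℤ n *ℤ v)
  factor = solve-∀

record Odd (o : ℤ) : Set where
  constructor mkOdd
  field
    half : ℤ
    eq   : o ≡ + 1 +ℤ + 2 *ℤ half

odd-one : Odd (+ 1)
odd-one = mkOdd (+ 0) refl

odd-* : ∀ {a b} → Odd a → Odd b → Odd (a *ℤ b)
odd-* (mkOdd x refl) (mkOdd y refl) = mkOdd (x +ℤ y +ℤ + 2 *ℤ (x *ℤ y)) (expand x y)
  where
  expand : ∀ x y → (+ 1 +ℤ + 2 *ℤ x) *ℤ (+ 1 +ℤ + 2 *ℤ y) ≡ + 1 +ℤ + 2 *ℤ (x +ℤ y +ℤ + 2 *ℤ (x *ℤ y))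
  expand = solve-∀

odd-neg : ∀ {a} → Odd a → Odd (-ℤ a)
odd-neg (mkOdd x refl) = mkOdd (-ℤ + 1 -ℤ x) (negate x)
  where
  negate : ∀ x → -ℤ (+ 1 +ℤ + 2 *ℤ x) ≡ + 1 +ℤ + 2 *ℤ (-ℤ + 1 -ℤ x)
  negate = solve-∀

odd-+even : ∀ {a} c → Odd a → Odd (a +ℤ + 2 *ℤ c)
odd-+even c (mkOdd x refl) = mkOdd (x +ℤ c) (collect x c)
  where
  collect : ∀ x y → + 1 +ℤ + 2 *ℤ x +ℤ + 2 *ℤ y ≡ + 1 +ℤ + 2 *ℤ (x +ℤ y)
  collect = solve-∀

odd-ℕ : ∀ {n} q → n ≡ 1 + q * 2 → Odd (+ n)
odd-ℕ q refl = mkOdd (+ q) (trans (ℤP.pos-+ 1 (q * 2)) (cong (+ 1 +ℤ_) (trans (ℤP.pos-* q 2) (ℤP.*-comm (+ q) (+ 2)))))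

odd≢even : ∀ {a} c → Odd a → a ≢ + 2 *ℤ c
odd≢even c (mkOdd x refl) odd≡even = two-∤-one {∣ c -ℤ x ∣} (trans (sym (ℤP.abs-* (+ 2) (c -ℤ x))) (cong ∣_∣ (sym one≡twice)))
  where
  cancel : ∀ x → + 1 ≡ (+ 1 +ℤ + 2 *ℤ x) -ℤ + 2 *ℤ x
  cancel = solve-∀
  factor : ∀ x y → + 2 *ℤ y -ℤ + 2 *ℤ x ≡ + 2 *ℤ (y -ℤ x)
  factor = solve-∀
  one≡twice : + 1 ≡ + 2 *ℤ (c -ℤ x)
  one≡twice = trans (cancel x) (trans (cong (_-ℤ + 2 *ℤ x) odd≡even) (factor x c))
  two-∤-one : ∀ {d} → 2 * d ≢ 1
  two-∤-one {d} e with ℕP.m*n≡1⇒m≡1 2 d e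
  ... | ()

record Val (z : ℤ) (v : ℕ) : Set where
  constructor mkVal
  field
    unit   : ℤ
    odd    : Odd unit
    factor : z ≡ + (2 ^ v) *ℤ unit

pos-^-+ : ∀ i j → + (2 ^ (i + j)) ≡ + (2 ^ i) *ℤ + (2 ^ j)
pos-^-+ i j = trans (cong +_ (ℕP.^-distribˡ-+-* 2 i j)) (ℤP.pos-* (2 ^ i) (2 ^ j))

pos-^-suc : ∀ v o → + (2 ^ suc v) *ℤ o ≡ + 2 *ℤ (+ (2 ^ v) *ℤ o)
pos-^-suc v o = trans (cong (_*ℤ o) (ℤP.pos-* 2 (2 ^ v))) (ℤP.*-assoc (+ 2) (+ (2 ^ v)) o)

odd→val : ∀ {x} → Odd x → Val x 0
odd→val {x} x-odd = mkVal x x-odd (sym (ℤP.*-identityˡ x))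

val-pow : ∀ v → Val (+ (2 ^ v)) v
val-pow v = mkVal (+ 1) odd-one (sym (ℤP.*-identityʳ _))

val-* : ∀ {x y v w} → Val x v → Val y w → Val (x *ℤ y) (v + w)
val-* {v = v} {w} (mkVal o o-odd refl) (mkVal o′ o′-odd refl) =
  mkVal (o *ℤ o′) (odd-* o-odd o′-odd)
        (trans (swap (+ (2 ^ v)) (+ (2 ^ w)) o o′) (cong (_*ℤ (o *ℤ o′)) (sym (pos-^-+ v w))))
  where
  swap : ∀ a b c d → (a *ℤ c) *ℤ (b *ℤ d) ≡ (a *ℤ b) *ℤ (c *ℤ d)
  swap = solve-∀

exponent-unique : ∀ v w {o o′} → Odd o → Odd o′ → + (2 ^ v) *ℤ o ≡ + (2 ^ w) *ℤ o′ → v ≡ w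
exponent-unique zero    zero    _     _      _ = refl
exponent-unique zero    (suc w) {o} {o′} o-odd _ e =
  ⊥-elim (odd≢even (+ (2 ^ w) *ℤ o′) o-odd (trans (sym (ℤP.*-identityˡ o)) (trans e (pos-^-suc w o′))))
exponent-unique (suc v) zero    {o} {o′} _ o′-odd e =
  ⊥-elim (odd≢even (+ (2 ^ v) *ℤ o) o′-odd (trans (sym (ℤP.*-identityˡ o′)) (trans (sym e) (pos-^-suc v o))))
exponent-unique (suc v) (suc w) {o} {o′} o-odd o′-odd e =
  cong suc (exponent-unique v w o-odd o′-odd (ℤP.*-cancelˡ-≡ (+ 2) _ _ (trans (sym (pos-^-suc v o)) (trans e (pos-^-suc w o′)))))

val-unique : ∀ {z v w} → Val z v → Val z w → v ≡ w
val-unique (mkVal o o-odd e) (mkVal o′ o′-odd e′) = exponent-unique _ _ o-odd o′-odd (trans (sym e) e′)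

val-zero : ∀ {v} → ¬ Val (+ 0) v
val-zero {zero}  (mkVal o o-odd e) = odd≢even (+ 0) o-odd (trans (sym (ℤP.*-identityˡ o)) (sym e))
val-zero {suc v} (mkVal o o-odd e) = val-zero {v} (mkVal o o-odd (ℤP.*-cancelˡ-≡ (+ 2) _ _ (trans e (pos-^-suc v o))))

parity : ∀ n → (Σ ℕ λ q → n ≡ q * 2) ⊎ (Σ ℕ λ q → n ≡ 1 + q * 2)
parity zero = inj₁ (0 , refl)
parity (suc n) with parity n
... | inj₁ (q , e) = inj₂ (q , cong suc e)
... | inj₂ (q , e) = inj₁ (suc q , cong suc e)

val-exists-ℕ : ∀ n → n ≢ 0 → Σ ℕ (Val (+ n))
val-exists-ℕ = <-rec (λ n → n ≢ 0 → Σ ℕ (Val (+ n))) halve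
  where
  halve : ∀ n → (∀ {q} → q < n → q ≢ 0 → Σ ℕ (Val (+ q))) → n ≢ 0 → Σ ℕ (Val (+ n))
  halve n rec n≢0 with parity n
  ... | inj₂ (q , n≡odd) = 0 , odd→val (odd-ℕ q n≡odd)
  ... | inj₁ (q , n≡q*2) with rec q<n q≢0
    where
    q≢0 : q ≢ 0
    q≢0 refl = n≢0 n≡q*2
    q<n : q < n
    q<n = subst (q <_) (sym n≡q*2) (ℕP.m<m*n q 2 {{≢-nonZero q≢0}} (s≤s (s≤s z≤n)))
  ... | v , mkVal o o-odd e =
    suc v , mkVal o o-odd (trans (cong +_ (trans n≡q*2 (ℕP.*-comm q 2)))
                          (trans (ℤP.pos-* 2 q) (trans (cong (+ 2 *ℤ_) e) (sym (pos-^-suc v o)))))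

val-exists : ∀ z → z ≢ + 0 → Σ ℕ (Val z)
val-exists (+ n)    z≢0 = val-exists-ℕ n (λ e → z≢0 (cong +_ e))
val-exists -[1+ n ] _ with val-exists-ℕ (suc n) (λ ())
... | v , mkVal o o-odd e = v , mkVal (-ℤ o) (odd-neg o-odd) (trans (cong -ℤ_ e) (ℤP.neg-distribʳ-* (+ (2 ^ v)) o))

val-abs : ∀ {z v} → Val z v → Val (+ ∣ z ∣) v
val-abs {v = v} (mkVal o o-odd refl) = mkVal (+ ∣ o ∣) (abs-odd o-odd)
  (trans (cong +_ (ℤP.abs-* (+ (2 ^ v)) o)) (ℤP.pos-* (2 ^ v) ∣ o ∣))
  where
  abs-odd : ∀ {o} → Odd o → Odd (+ ∣ o ∣)
  abs-odd {+ n}      o-odd = o-odd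
  abs-odd { -[1+ n ]} o-odd = odd-neg o-odd

val→ν₂ : ∀ {z v} → Val z v → ν₂≡ z v
val→ν₂ {z} {v} z-val@(mkVal o o-odd e) = 2^v∣z , 2^[1+v]∤z
  where
  2^v∣z : ℕDiv._∣_ (2 ^ v) ∣ z ∣
  2^v∣z = ℕDiv.divides ∣ o ∣ (trans (cong ∣_∣ e) (trans (ℤP.abs-* (+ (2 ^ v)) o) (ℕP.*-comm (2 ^ v) ∣ o ∣)))
  2^[1+v]∤z : ¬ ℕDiv._∣_ (2 ^ suc v) ∣ z ∣
  2^[1+v]∤z (ℕDiv.divides q ∣z∣≡q*2^[1+v]) = ℕP.<-irrefl refl (subst (suc v ≤_) (sym v≡) (ℕP.m≤n+m (suc v) w))
    where
    ∣z∣-val : Val (+ ∣ z ∣) v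
    ∣z∣-val = val-abs z-val
    q≢0 : + q ≢ + 0
    q≢0 e0 = val-zero (subst (λ t → Val t v) (trans (cong +_ ∣z∣≡q*2^[1+v]) (cong (λ t → + (t * 2 ^ suc v)) (ℤP.+-injective e0))) ∣z∣-val)
    w : ℕ
    w = proj₁ (val-exists (+ q) q≢0)
    v≡ : v ≡ w + suc v
    v≡ = val-unique ∣z∣-val (subst (λ t → Val t (w + suc v)) (sym (trans (cong +_ ∣z∣≡q*2^[1+v]) (ℤP.pos-* q (2 ^ suc v))))
                              (val-* (proj₂ (val-exists (+ q) q≢0)) (val-pow (suc v))))

val-≤ : ∀ {n v} → Val (+ n) v → 2 ^ v ≤ n
val-≤ {n} {v} (mkVal o o-odd e) = subst (2 ^ v ≤_) (sym n≡) (ℕP.m≤m*n (2 ^ v) ∣ o ∣ {{≢-nonZero ∣o∣≢0}})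
  where
  n≡ : n ≡ 2 ^ v * ∣ o ∣
  n≡ = trans (cong ∣_∣ e) (ℤP.abs-* (+ (2 ^ v)) o)
  ∣o∣≢0 : ∣ o ∣ ≢ 0
  ∣o∣≢0 e0 = odd≢even (+ 0) o-odd (ℤP.∣i∣≡0⇒i≡0 e0)

-- Congruences in ℤ_(2):  Div₂ e x w  says that 2^e · w divides x in ℤ_(2),
-- i.e. o · x = 2^e · w · z for some odd o and some z.

record Div₂ (e : ℕ) (x w : ℤ) : Set where
  constructor mkDiv₂
  field
    unit     : ℤ
    quotient : ℤ
    odd      : Odd unit
    eq       : unit *ℤ x ≡ + (2 ^ e) *ℤ w *ℤ quotient

div-zero : ∀ {e w} → Div₂ e (+ 0) w
div-zero {e} {w} = mkDiv₂ (+ 1) (+ 0) odd-one (sym (ℤP.*-zeroʳ (+ (2 ^ e) *ℤ w)))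

div-+ : ∀ {e x y w} → Div₂ e x w → Div₂ e y w → Div₂ e (x +ℤ y) w
div-+ {e} {x} {y} {w} (mkDiv₂ o₁ z₁ o₁-odd e₁) (mkDiv₂ o₂ z₂ o₂-odd e₂) =
  mkDiv₂ (o₁ *ℤ o₂) (o₂ *ℤ z₁ +ℤ o₁ *ℤ z₂) (odd-* o₁-odd o₂-odd)
    (trans (spread o₁ o₂ x y) (trans (cong₂ (λ s t → o₂ *ℤ s +ℤ o₁ *ℤ t) e₁ e₂) (gather o₁ o₂ (+ (2 ^ e) *ℤ w) z₁ z₂)))
  where
  spread : ∀ a b x y → (a *ℤ b) *ℤ (x +ℤ y) ≡ b *ℤ (a *ℤ x) +ℤ a *ℤ (b *ℤ y)
  spread = solve-∀
  gather : ∀ a b p z₁ z₂ → b *ℤ (p *ℤ z₁) +ℤ a *ℤ (p *ℤ z₂) ≡ p *ℤ (b *ℤ z₁ +ℤ a *ℤ z₂)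
  gather = solve-∀

div-* : ∀ {e f x₁ x₂ w₁ w₂} → Div₂ e x₁ w₁ → Div₂ f x₂ w₂ → Div₂ (e + f) (x₁ *ℤ x₂) (w₁ *ℤ w₂)
div-* {e} {f} {x₁} {x₂} {w₁} {w₂} (mkDiv₂ o₁ z₁ o₁-odd e₁) (mkDiv₂ o₂ z₂ o₂-odd e₂) =
  mkDiv₂ (o₁ *ℤ o₂) (z₁ *ℤ z₂) (odd-* o₁-odd o₂-odd)
    (trans (pair o₁ o₂ x₁ x₂) (trans (cong₂ _*ℤ_ e₁ e₂) (trans (regroup (+ (2 ^ e)) (+ (2 ^ f)) w₁ w₂ z₁ z₂)
      (cong (λ t → t *ℤ (w₁ *ℤ w₂) *ℤ (z₁ *ℤ z₂)) (sym (pos-^-+ e f))))))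
  where
  pair : ∀ a b x y → (a *ℤ b) *ℤ (x *ℤ y) ≡ (a *ℤ x) *ℤ (b *ℤ y)
  pair = solve-∀
  regroup : ∀ p q w₁ w₂ z₁ z₂ → (p *ℤ w₁ *ℤ z₁) *ℤ (q *ℤ w₂ *ℤ z₂) ≡ (p *ℤ q) *ℤ (w₁ *ℤ w₂) *ℤ (z₁ *ℤ z₂)
  regroup = solve-∀

div-*ˡ : ∀ {e x w} c → Div₂ e x w → Div₂ e (c *ℤ x) (c *ℤ w)
div-*ˡ {e} {x} {w} c (mkDiv₂ o z o-odd e₁) =
  mkDiv₂ o z o-odd (trans (commute o c x) (trans (cong (c *ℤ_) e₁) (regroup c (+ (2 ^ e)) w z)))
  where
  commute : ∀ o c x → o *ℤ (c *ℤ x) ≡ c *ℤ (o *ℤ x)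
  commute = solve-∀
  regroup : ∀ c p w z → c *ℤ (p *ℤ w *ℤ z) ≡ p *ℤ (c *ℤ w) *ℤ z
  regroup = solve-∀

div-weaken : ∀ {e x w} → Div₂ (suc e) x w → Div₂ 1 x w
div-weaken {e} {x} {w} (mkDiv₂ o z o-odd e₁) = mkDiv₂ o (+ (2 ^ e) *ℤ z) o-odd (trans e₁ (regroup w z))
  where
  move : ∀ p w z → + 2 *ℤ p *ℤ w *ℤ z ≡ + 2 *ℤ w *ℤ (p *ℤ z)
  move = solve-∀
  regroup : ∀ w z → + (2 * 2 ^ e) *ℤ w *ℤ z ≡ + 2 *ℤ w *ℤ (+ (2 ^ e) *ℤ z)
  regroup w z = trans (cong (λ t → t *ℤ w *ℤ z) (ℤP.pos-* 2 (2 ^ e))) (move (+ (2 ^ e)) w z)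

div-twice : ∀ b w → Div₂ 1 (+ 2 *ℤ (b *ℤ w)) w
div-twice b w = mkDiv₂ (+ 1) b odd-one (regroup b w)
  where
  regroup : ∀ b w → + 1 *ℤ (+ 2 *ℤ (b *ℤ w)) ≡ + 2 *ℤ w *ℤ b
  regroup = solve-∀

div-conv : ∀ {e w} m (g : ℕ → ℕ → ℤ) → (∀ i j → i + j ≡ m → Div₂ e (g i j) w) → Div₂ e (conv m g) w
div-conv zero    g g-div = g-div 0 0 refl
div-conv (suc m) g g-div = div-+ (g-div 0 (suc m) refl) (div-conv m (λ a b → g (suc a) b) (λ i j e → g-div (suc i) j (cong suc e)))

div-cong : ∀ {e e′ x x′ w w′} → e ≡ e′ → x ≡ x′ → w ≡ w′ → Div₂ e x w → Div₂ e′ x′ w′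
div-cong refl refl refl d = d

val-from-congruence : ∀ {A b W vb vW h} → Div₂ (suc h) (A -ℤ b *ℤ W) W → Val b vb → Val W vW → vb ≤ h →
  Val A (vb + vW)
val-from-congruence {A} {b} {W} {vb} {vW} {h} (mkDiv₂ o z o-odd e₁) (mkVal ob ob-odd eb) (mkVal oW oW-odd eW) vb≤h =
  subst (Val A) (val-unique (val-* (odd→val o-odd) A-val) oA-val) A-val
  where
  P Q D : ℤ
  P = + (2 ^ vb)
  Q = + (2 ^ vW)
  D = + (2 ^ (h ∸ vb))
  2^[1+h] : + (2 ^ suc h) ≡ + 2 *ℤ P *ℤ D
  2^[1+h] = trans (cong (λ t → + (2 ^ suc t)) (sym (ℕP.m+[n∸m]≡n vb≤h)))
              (trans (ℤP.pos-* 2 (2 ^ (vb + (h ∸ vb)))) (trans (cong (+ 2 *ℤ_) (pos-^-+ vb (h ∸ vb))) (sym (ℤP.*-assoc (+ 2) P D))))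
  split : ∀ o A x → o *ℤ A ≡ o *ℤ (A -ℤ x) +ℤ o *ℤ x
  split = solve-∀
  collect : ∀ o P Q D ob oW z → + 2 *ℤ P *ℤ D *ℤ (Q *ℤ oW) *ℤ z +ℤ o *ℤ ((P *ℤ ob) *ℤ (Q *ℤ oW))
          ≡ (P *ℤ Q) *ℤ (o *ℤ ob *ℤ oW +ℤ + 2 *ℤ (D *ℤ oW *ℤ z))
  collect = solve-∀
  -- o·A = o·(A − bW) + o·bW = 2^(vb+vW) · (odd + even)
  oA≡ : o *ℤ A ≡ + (2 ^ (vb + vW)) *ℤ (o *ℤ ob *ℤ oW +ℤ + 2 *ℤ (D *ℤ oW *ℤ z))
  oA≡ = begin
      o *ℤ A                                                      ≡⟨ split o A (b *ℤ W) ⟩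
      o *ℤ (A -ℤ b *ℤ W) +ℤ o *ℤ (b *ℤ W)                         ≡⟨ cong₂ (λ t u → t +ℤ o *ℤ u) e₁ (cong₂ _*ℤ_ eb eW) ⟩
      + (2 ^ suc h) *ℤ W *ℤ z +ℤ o *ℤ ((P *ℤ ob) *ℤ (Q *ℤ oW))    ≡⟨ cong₂ (λ t u → t *ℤ u *ℤ z +ℤ o *ℤ ((P *ℤ ob) *ℤ (Q *ℤ oW))) 2^[1+h] eW ⟩
      + 2 *ℤ P *ℤ D *ℤ (Q *ℤ oW) *ℤ z +ℤ o *ℤ ((P *ℤ ob) *ℤ (Q *ℤ oW))
                                                                  ≡⟨ collect o P Q D ob oW z ⟩
      (P *ℤ Q) *ℤ (o *ℤ ob *ℤ oW +ℤ + 2 *ℤ (D *ℤ oW *ℤ z))        ≡⟨ cong (_*ℤ (o *ℤ ob *ℤ oW +ℤ + 2 *ℤ (D *ℤ oW *ℤ z))) (pos-^-+ vb vW) ⟨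
      + (2 ^ (vb + vW)) *ℤ (o *ℤ ob *ℤ oW +ℤ + 2 *ℤ (D *ℤ oW *ℤ z)) ∎
    where open ≡-Reasoning
  oA-val : Val (o *ℤ A) (vb + vW)
  oA-val = mkVal _ (odd-+even (D *ℤ oW *ℤ z) (odd-* (odd-* o-odd ob-odd) oW-odd)) oA≡
  A≢0 : A ≢ + 0
  A≢0 A≡0 = val-zero (subst (λ t → Val t (vb + vW)) (trans (cong (o *ℤ_) A≡0) (ℤP.*-zeroʳ o)) oA-val)
  A-val : Val A (proj₁ (val-exists A A≢0))
  A-val = proj₂ (val-exists A A≢0)

-- The key congruence (⋆):  stir K i ≡ binom K i  modulo 2^e · fact K i in ℤ_(2),
-- with e = h + 1 for K = 2^h.

stir fact binom : ℕ → ℕ → ℤ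
stir  K i = + (2 ^ i) *ℤ (+ (K !) *ℤ s (K + i) K)
fact  K i = + ((K + i) !)
binom K i = + (K C i) *ℤ fact K i

Congruence : ℕ → ℕ → Set
Congruence K e = ∀ i → Div₂ e (stir K i -ℤ binom K i) (fact K i)

stirling-convolution-diag : ∀ K m →
  + B K K *ℤ s (K + K + m) (K + K) ≡ conv m (λ i j → + B (K + i) (K + j) *ℤ (s (K + i) K *ℤ s (K + j) K))
stirling-convolution-diag K m = begin
    + B K K *ℤ s (K + K + m) (K + K)
  ≡⟨ stirling-convolution (K + K + m) K K ⟨
    conv (K + K + m) g
  ≡⟨ cong (λ t → conv t g) (ℕP.+-assoc K K m) ⟩
    conv (K + (K + m)) g
  ≡⟨ conv-dropˡ K (K + m) g (λ a b a<K → trans (cong (λ t → + B a b *ℤ (t *ℤ s b K)) (s-below a K a<K)) (ℤP.*-zeroʳ (+ B a b))) ⟩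
    conv (K + m) (λ a b → g (K + a) b)
  ≡⟨ cong (λ t → conv t (λ a b → g (K + a) b)) (ℕP.+-comm K m) ⟩
    conv (m + K) (λ a b → g (K + a) b)
  ≡⟨ conv-dropʳ K m (λ a b → g (K + a) b) (λ a b b<K → trans (cong (λ t → + B (K + a) b *ℤ (s (K + a) K *ℤ t)) (s-below b K b<K))
                                                       (trans (cong (+ B (K + a) b *ℤ_) (ℤP.*-zeroʳ (s (K + a) K))) (ℤP.*-zeroʳ (+ B (K + a) b)))) ⟩
    conv m (λ i j → g (K + i) (K + j)) ∎
  where
  open ≡-Reasoning
  g : ℕ → ℕ → ℤ
  g a b = + B a b *ℤ (s a K *ℤ s b K)

stir-double : ∀ K m → stir (K + K) m ≡ conv m (λ i j → + B (K + i) (K + j) *ℤ (stir K i *ℤ stir K j))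
stir-double K m = begin
    + (2 ^ m) *ℤ (+ ((K + K) !) *ℤ s (K + K + m) (K + K))
  ≡⟨ cong (λ t → + (2 ^ m) *ℤ (t *ℤ s (K + K + m) (K + K))) (cong +_ (sym (B-fac K K))) ⟩
    + (2 ^ m) *ℤ (+ (B K K * (K ! * K !)) *ℤ s (K + K + m) (K + K))
  ≡⟨ cong (λ t → + (2 ^ m) *ℤ (t *ℤ s (K + K + m) (K + K))) (trans (ℤP.pos-* (B K K) _) (cong (+ B K K *ℤ_) (ℤP.pos-* (K !) (K !)))) ⟩
    + (2 ^ m) *ℤ (+ B K K *ℤ (+ (K !) *ℤ + (K !)) *ℤ s (K + K + m) (K + K))
  ≡⟨ pull-out (+ (2 ^ m)) (+ B K K) (+ (K !)) (s (K + K + m) (K + K)) ⟩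
    c *ℤ (+ B K K *ℤ s (K + K + m) (K + K))
  ≡⟨ cong (c *ℤ_) (stirling-convolution-diag K m) ⟩
    c *ℤ conv m (λ i j → + B (K + i) (K + j) *ℤ (s (K + i) K *ℤ s (K + j) K))
  ≡⟨ conv-*ˡ m c _ ⟨
    conv m (λ i j → c *ℤ (+ B (K + i) (K + j) *ℤ (s (K + i) K *ℤ s (K + j) K)))
  ≡⟨ conv-cong m distribute ⟩
    conv m (λ i j → + B (K + i) (K + j) *ℤ (stir K i *ℤ stir K j)) ∎
  where
  open ≡-Reasoning
  c : ℤ
  c = + (2 ^ m) *ℤ (+ (K !) *ℤ + (K !))
  pull-out : ∀ p b f x → p *ℤ (b *ℤ (f *ℤ f) *ℤ x) ≡ (p *ℤ (f *ℤ f)) *ℤ (b *ℤ x)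
  pull-out = solve-∀
  share : ∀ p q f b x y → (p *ℤ q *ℤ (f *ℤ f)) *ℤ (b *ℤ (x *ℤ y)) ≡ b *ℤ ((p *ℤ (f *ℤ x)) *ℤ (q *ℤ (f *ℤ y)))
  share = solve-∀
  -- 2^m = 2^i · 2^j distributes one factor 2^i K! to each side.
  distribute : ∀ i j → i + j ≡ m →
    c *ℤ (+ B (K + i) (K + j) *ℤ (s (K + i) K *ℤ s (K + j) K)) ≡ + B (K + i) (K + j) *ℤ (stir K i *ℤ stir K j)
  distribute i j i+j≡m = trans (cong (λ t → (t *ℤ (+ (K !) *ℤ + (K !))) *ℤ (+ B (K + i) (K + j) *ℤ (s (K + i) K *ℤ s (K + j) K))) (trans (cong (λ t → + (2 ^ t)) (sym i+j≡m)) (pos-^-+ i j)))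
                                (share (+ (2 ^ i)) (+ (2 ^ j)) (+ (K !)) (+ B (K + i) (K + j)) (s (K + i) K) (s (K + j) K))

fact-split : ∀ K m i j → i + j ≡ m → fact (K + K) m ≡ + B (K + i) (K + j) *ℤ (fact K i *ℤ fact K j)
fact-split K m i j i+j≡m = begin
    + ((K + K + m) !)                                    ≡⟨ cong (λ t → + (t !)) (trans (cong (λ t → K + K + t) (sym i+j≡m)) (interleave K i j)) ⟩
    + ((K + i + (K + j)) !)                              ≡⟨ cong +_ (B-fac (K + i) (K + j)) ⟨
    + (B (K + i) (K + j) * ((K + i) ! * (K + j) !))      ≡⟨ ℤP.pos-* (B (K + i) (K + j)) _ ⟩
    + B (K + i) (K + j) *ℤ + ((K + i) ! * (K + j) !)     ≡⟨ cong (+ B (K + i) (K + j) *ℤ_) (ℤP.pos-* ((K + i) !) ((K + j) !)) ⟩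
    + B (K + i) (K + j) *ℤ (fact K i *ℤ fact K j)        ∎
  where
  open ≡-Reasoning
  interleave : ∀ K i j → K + K + (i + j) ≡ K + i + (K + j)
  interleave = ℕSolver.solve-∀

binom-double : ∀ K m → binom (K + K) m ≡ conv m (λ i j → + B (K + i) (K + j) *ℤ (binom K i *ℤ binom K j))
binom-double K m = begin
    + ((K + K) C m) *ℤ fact (K + K) m
  ≡⟨ cong (_*ℤ fact (K + K) m) (vandermonde K K m) ⟩
    conv m (λ i j → + ((K C i) * (K C j))) *ℤ fact (K + K) m
  ≡⟨ ℤP.*-comm (conv m (λ i j → + ((K C i) * (K C j)))) (fact (K + K) m) ⟩
    fact (K + K) m *ℤ conv m (λ i j → + ((K C i) * (K C j)))
  ≡⟨ conv-*ˡ m (fact (K + K) m) (λ i j → + ((K C i) * (K C j))) ⟨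
    conv m (λ i j → fact (K + K) m *ℤ + ((K C i) * (K C j)))
  ≡⟨ conv-cong m distribute ⟩
    conv m (λ i j → + B (K + i) (K + j) *ℤ (binom K i *ℤ binom K j)) ∎
  where
  open ≡-Reasoning
  share : ∀ b wi wj ci cj → (b *ℤ (wi *ℤ wj)) *ℤ (ci *ℤ cj) ≡ b *ℤ ((ci *ℤ wi) *ℤ (cj *ℤ wj))
  share = solve-∀
  distribute : ∀ i j → i + j ≡ m → fact (K + K) m *ℤ + ((K C i) * (K C j)) ≡ + B (K + i) (K + j) *ℤ (binom K i *ℤ binom K j)
  distribute i j i+j≡m = trans (cong₂ _*ℤ_ (fact-split K m i j i+j≡m) (ℤP.pos-* (K C i) (K C j)))
                               (share (+ B (K + i) (K + j)) (fact K i) (fact K j) (+ (K C i)) (+ (K C j)))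

-- Doubling K gains one power of 2: each term of
--   stir (2K) m − binom (2K) m = Σ C(2K+m, K+i) (stir K i − binom K i)(stir K j + binom K j)
-- is divisible by 2^(e+1) · fact K i in its first factor and by 2 · fact K j in its second.
congruence-double : ∀ K e → Congruence K (suc e) → Congruence (K + K) (suc (suc e))
congruence-double K e cong-K m =
  div-cong refl (sym difference) refl (div-conv m _ term-div)
  where
  c : ℕ → ℕ → ℤ
  c i j = + B (K + i) (K + j)
  difference : stir (K + K) m -ℤ binom (K + K) m ≡
    conv m (λ i j → c i j *ℤ ((stir K i -ℤ binom K i) *ℤ (stir K j +ℤ binom K j)))
  difference = trans (cong₂ _-ℤ_ (stir-double K m) (binom-double K m))
    (trans (sym (conv-- m (λ i j → c i j *ℤ (stir K i *ℤ stir K j)) (λ i j → c i j *ℤ (binom K i *ℤ binom K j))))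
           (conv-difference-of-squares m c (stir K) (binom K) (λ i j → cong +_ (B-sym (K + i) (K + j)))))
  add-back : ∀ a b w → (a -ℤ b *ℤ w) +ℤ + 2 *ℤ (b *ℤ w) ≡ a +ℤ b *ℤ w
  add-back = solve-∀
  -- stir + binom = (stir − binom) + 2 · binom
  sum-div : ∀ j → Div₂ 1 (stir K j +ℤ binom K j) (fact K j)
  sum-div j = div-cong refl (add-back (stir K j) (+ (K C j)) (fact K j)) refl
                (div-+ (div-weaken (cong-K j)) (div-twice (+ (K C j)) (fact K j)))
  term-div : ∀ i j → i + j ≡ m →
    Div₂ (suc (suc e)) (c i j *ℤ ((stir K i -ℤ binom K i) *ℤ (stir K j +ℤ binom K j))) (fact (K + K) m)
  term-div i j i+j≡m = div-cong (ℕP.+-comm (suc e) 1) refl (sym (fact-split K m i j i+j≡m))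
                         (div-*ˡ (c i j) (div-* (cong-K i) (sum-div j)))

-- n + 3 < 2^(n+2); that is, i + 1 < 2^i for i ≥ 2, whence ν₂(i+1) < i.
pow-grows : ∀ n → 3 + n < 2 ^ (2 + n)
pow-grows zero    = ℕP.≤-refl
pow-grows (suc n) = ℕP.≤-trans (ℕP.≤-trans (ℕP.m≤m+n (5 + n) (3 + n)) (ℕP.≤-reflexive (rearrange n)))
                              (ℕP.+-mono-≤ (pow-grows n) (ℕP.+-mono-≤ (pow-grows n) (z≤n {0})))
  where
  rearrange : ∀ n → 5 + n + (3 + n) ≡ 4 + n + (4 + n + 0)
  rearrange = ℕSolver.solve-∀

-- K = 1: stir 1 i = 2^i (−1)^i i!, while binom 1 i = 0 for i ≥ 2.  Writing
-- i + 1 = 2^v · o with o odd and v < i gives o · stir 1 i = 2 · (i+1)! · 2^(i−1−v) (−1)^i.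
congruence-one : Congruence 1 1
congruence-one zero          = div-zero
congruence-one (suc zero)    = mkDiv₂ (+ 1) -[1+ 0 ] odd-one refl
congruence-one (suc (suc n)) with val-exists-ℕ (3 + n) (λ ())
... | v , i+1-val@(mkVal o o-odd i+1≡) =
  div-cong refl (sym (ℤP.+-identityʳ _)) refl (mkDiv₂ o (+ (2 ^ d) *ℤ sign i) o-odd o·stir≡)
  where
  i d : ℕ
  i = 2 + n
  d = i ∸ suc v
  v<i : suc v ≤ i
  v<i = ℕP.≰⇒> (λ i≤v → ℕP.<-irrefl refl (ℕP.≤-trans (pow-grows n) (ℕP.≤-trans (ℕP.^-monoʳ-≤ 2 i≤v) (val-≤ i+1-val))))
  2^i≡ : + (2 ^ i) ≡ + 2 *ℤ + (2 ^ v) *ℤ + (2 ^ d)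
  2^i≡ = trans (cong (λ t → + (2 ^ t)) (sym (ℕP.m+[n∸m]≡n v<i)))
            (trans (pos-^-+ (suc v) d) (cong (_*ℤ + (2 ^ d)) (ℤP.pos-* 2 (2 ^ v))))
  fact≡ : + (suc i !) ≡ (+ (2 ^ v) *ℤ o) *ℤ + (i !)
  fact≡ = trans (ℤP.pos-* (suc i) (i !)) (cong (_*ℤ + (i !)) i+1≡)
  regroup : ∀ o P D sg f → o *ℤ ((+ 2 *ℤ P *ℤ D) *ℤ (+ 1 *ℤ (sg *ℤ f))) ≡ + 2 *ℤ ((P *ℤ o) *ℤ f) *ℤ (D *ℤ sg)
  regroup = solve-∀
  o·stir≡ : o *ℤ (+ (2 ^ i) *ℤ (+ 1 *ℤ s (suc i) 1)) ≡ + 2 *ℤ + (suc i !) *ℤ (+ (2 ^ d) *ℤ sign i)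
  o·stir≡ = trans (cong₂ (λ a b → o *ℤ (a *ℤ (+ 1 *ℤ b))) 2^i≡ (s-col1 i))
              (trans (regroup o (+ (2 ^ v)) (+ (2 ^ d)) (sign i) (+ (i !))) (cong (λ t → + 2 *ℤ t *ℤ (+ (2 ^ d) *ℤ sign i)) (sym fact≡)))

congruence : ∀ h → Congruence (2 ^ h) (suc h)
congruence zero    = congruence-one
congruence (suc h) = subst (λ K → Congruence K (suc (suc h))) (cong (λ t → 2 ^ h + t) (sym (ℕP.+-identityʳ (2 ^ h))))
                       (congruence-double (2 ^ h) h (congruence h))

popcount-fuel : ∀ f g m → m ≤ f → m ≤ g → popcountAux f m ≡ popcountAux g m
popcount-fuel zero    zero    m       _         _         = refl
popcount-fuel zero    (suc g) zero    _         _         = refl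
popcount-fuel (suc f) zero    zero    _         _         = refl
popcount-fuel (suc f) (suc g) zero    _         _         = refl
popcount-fuel (suc f) (suc g) (suc m) (s≤s m≤f) (s≤s m≤g) =
  cong (λ t → suc m % 2 + t) (popcount-fuel f g (suc m / 2) (half≤ m≤f) (half≤ m≤g))
  where
  half≤ : ∀ {k} → m ≤ k → suc m / 2 ≤ k
  half≤ m≤k = ℕP.≤-trans (ℕP.≤-pred (ℕDivMod.m/n<m (suc m) 2 (s≤s (s≤s z≤n)))) m≤k

σ-even : ∀ q → σ₂ (q * 2) ≡ σ₂ q
σ-even zero    = refl
σ-even (suc q) = cong₂ _+_ (ℕDivMod.m*n%n≡0 (suc q) 2)
   (trans (cong (popcountAux (suc (q * 2))) (ℕDivMod.m*n/n≡m (suc q) 2))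
          (popcount-fuel (suc (q * 2)) (suc q) (suc q) (s≤s (ℕP.m≤m*n q 2)) ℕP.≤-refl))

σ-odd : ∀ q → σ₂ (1 + q * 2) ≡ suc (σ₂ q)
σ-odd q = cong₂ _+_ (ℕDivMod.[m+kn]%n≡m%n 1 q 2)
   (trans (cong (popcountAux (q * 2)) half) (popcount-fuel (q * 2) q q (ℕP.m≤m*n q 2) ℕP.≤-refl))
  where
  half : (1 + q * 2) / 2 ≡ q
  half = trans (ℕDivMod.+-distrib-/ 1 (q * 2) (subst (λ t → 1 + t < 2) (sym (ℕDivMod.m*n%n≡0 q 2)) ℕP.≤-refl))
               (ℕDivMod.m*n/n≡m q 2)

val-halve : ∀ {x v} → x ≢ 0 → Val (+ (x * 2)) v → Σ ℕ λ v′ → (v ≡ suc v′) × Val (+ x) v′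
val-halve {x} x≢0 2x-val with val-exists-ℕ x x≢0
... | v′ , x-val = v′ , val-unique 2x-val 2x-val′ , x-val
  where
  2x-val′ : Val (+ (x * 2)) (suc v′)
  2x-val′ = subst (λ t → Val t (suc v′)) (trans (sym (ℤP.pos-* 2 x)) (cong +_ (ℕP.*-comm 2 x)))
              (val-* (val-pow 1) x-val)

-- Adding 1 turns the trailing ones of m into zeros:  σ₂(m+1) + ν₂(m+1) = σ₂(m) + 1.
carry : ∀ m {v} → Val (+ suc m) v → σ₂ (suc m) + v ≡ σ₂ m + 1
carry = <-rec (λ m → ∀ {v} → Val (+ suc m) v → σ₂ (suc m) + v ≡ σ₂ m + 1) step
  where
  step : ∀ m → (∀ {q} → q < m → ∀ {v} → Val (+ suc q) v → σ₂ (suc q) + v ≡ σ₂ q + 1) →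
         ∀ {v} → Val (+ suc m) v → σ₂ (suc m) + v ≡ σ₂ m + 1
  step m rec {v} m+1-val with parity m
  ... | inj₁ (q , refl) = begin
      σ₂ (1 + q * 2) + v      ≡⟨ cong₂ _+_ (σ-odd q) (val-unique m+1-val (odd→val (odd-ℕ q refl))) ⟩
      suc (σ₂ q) + 0          ≡⟨ trans (ℕP.+-identityʳ _) (ℕP.+-comm 1 (σ₂ q)) ⟩
      σ₂ q + 1                ≡⟨ cong (_+ 1) (σ-even q) ⟨
      σ₂ (q * 2) + 1          ∎
    where open ≡-Reasoning
  ... | inj₂ (q , refl) with val-halve {suc q} (λ ()) m+1-val
  ...   | v′ , refl , q+1-val = begin
      σ₂ (suc q * 2) + suc v′    ≡⟨ cong (_+ suc v′) (σ-even (suc q)) ⟩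
      σ₂ (suc q) + suc v′        ≡⟨ ℕP.+-suc (σ₂ (suc q)) v′ ⟩
      suc (σ₂ (suc q) + v′)      ≡⟨ cong suc (rec (s≤s (ℕP.m≤m*n q 2)) q+1-val) ⟩
      suc (σ₂ q + 1)             ≡⟨ cong (_+ 1) (σ-odd q) ⟨
      σ₂ (1 + q * 2) + 1         ∎
    where open ≡-Reasoning

factorial≢0 : ∀ n → n ! ≢ 0
factorial≢0 n = ℕP.n>0⇒n≢0 (ℕP.1≤n! n)

legendre : ∀ m {b} → Val (+ (m !)) b → b + σ₂ m ≡ m
legendre zero    1-val = cong (_+ 0) (val-unique 1-val (val-pow 0))
legendre (suc m) {b} [m+1]!-val with val-exists-ℕ (suc m) (λ ()) | val-exists-ℕ (m !) (factorial≢0 m)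
... | v , m+1-val | b′ , m!-val = begin
    b + σ₂ (suc m)              ≡⟨ cong (_+ σ₂ (suc m)) b≡ ⟩
    (v + b′) + σ₂ (suc m)       ≡⟨ rearrange v b′ (σ₂ (suc m)) ⟩
    b′ + (σ₂ (suc m) + v)       ≡⟨ cong (λ t → b′ + t) (carry m m+1-val) ⟩
    b′ + (σ₂ m + 1)             ≡⟨ ℕP.+-assoc b′ (σ₂ m) 1 ⟨
    (b′ + σ₂ m) + 1             ≡⟨ cong (_+ 1) (legendre m m!-val) ⟩
    m + 1                       ≡⟨ ℕP.+-comm m 1 ⟩
    suc m                       ∎
  where
  open ≡-Reasoning
  rearrange : ∀ a b c → (a + b) + c ≡ b + (c + a)
  rearrange = ℕSolver.solve-∀
  b≡ : b ≡ v + b′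
  b≡ = val-unique [m+1]!-val (subst (λ t → Val t (v + b′)) (sym (ℤP.pos-* (suc m) (m !))) (val-* m+1-val m!-val))

exponent-< : ∀ {v h n} → 2 ^ v ≤ n → n < 2 ^ h → v < h
exponent-< 2^v≤n n<2^h = ℕP.≰⇒> (λ h≤v → ℕP.<-irrefl refl (ℕP.≤-trans n<2^h (ℕP.≤-trans (ℕP.^-monoʳ-≤ 2 h≤v) 2^v≤n)))

σ-leading-one : ∀ h m → m < 2 ^ h → σ₂ (2 ^ h + m) ≡ suc (σ₂ m)
σ-leading-one zero    zero    _ = refl
σ-leading-one zero    (suc m) (s≤s ())
σ-leading-one (suc h) m m<2K with parity m
... | inj₁ (q , refl) =
  trans (cong σ₂ (shift (2 ^ h) q)) (trans (σ-even (2 ^ h + q)) (trans (σ-leading-one h q q<K) (cong suc (sym (σ-even q)))))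
  where
  shift : ∀ K q → 2 * K + q * 2 ≡ (K + q) * 2
  shift = ℕSolver.solve-∀
  q<K : q < 2 ^ h
  q<K = ℕP.*-cancelʳ-< 2 q (2 ^ h) (subst (q * 2 <_) (ℕP.*-comm 2 (2 ^ h)) m<2K)
... | inj₂ (q , refl) =
  trans (cong σ₂ (shift (2 ^ h) q)) (trans (σ-odd (2 ^ h + q)) (cong suc (trans (σ-leading-one h q q<K) (sym (σ-odd q)))))
  where
  shift : ∀ K q → 2 * K + (1 + q * 2) ≡ 1 + (K + q) * 2
  shift = ℕSolver.solve-∀
  q<K : q < 2 ^ h
  q<K = ℕP.*-cancelʳ-< 2 q (2 ^ h) (subst (q * 2 <_) (ℕP.*-comm 2 (2 ^ h)) (ℕP.<-trans (ℕP.n<1+n (q * 2)) m<2K))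

pow-pred : ∀ h → Σ ℕ λ K′ → 2 ^ h ≡ suc K′
pow-pred h = 2 ^ h ∸ 1 , sym (ℕP.suc-pred (2 ^ h) {{ℕP.m^n≢0 2 h}})

σ-all-ones : ∀ h K′ → 2 ^ h ≡ suc K′ → σ₂ K′ ≡ h
σ-all-ones h K′ 2^h≡ = ℕP.+-cancelʳ-≡ 1 (σ₂ K′) h (trans (sym (carry K′ K-val)) (trans (cong (_+ h) σK≡1) (ℕP.+-comm 1 h)))
  where
  K-val : Val (+ suc K′) h
  K-val = subst (λ t → Val (+ t) h) 2^h≡ (val-pow h)
  σK≡1 : σ₂ (suc K′) ≡ 1
  σK≡1 = trans (cong σ₂ (trans (sym 2^h≡) (sym (ℕP.+-identityʳ (2 ^ h))))) (σ-leading-one h 0 (subst (0 <_) (sym 2^h≡) (s≤s z≤n)))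

-- ν₂(K + i) = ν₂(i) for 0 < i < K: the leading bit of K + i lies above the trailing zeros of i.
val-+pow : ∀ h i {v} → i < 2 ^ h → Val (+ i) v → Val (+ (2 ^ h + i)) v
val-+pow h i {v} i<K i-val@(mkVal o o-odd i≡) = mkVal (o +ℤ + 2 *ℤ + (2 ^ d)) (odd-+even (+ (2 ^ d)) o-odd) K+i≡
  where
  v<h : v < h
  v<h = exponent-< (val-≤ i-val) i<K
  d : ℕ
  d = h ∸ suc v
  K≡ : + (2 ^ h) ≡ + 2 *ℤ (+ (2 ^ v) *ℤ + (2 ^ d))
  K≡ = trans (cong (λ t → + (2 ^ t)) (sym (ℕP.m+[n∸m]≡n v<h)))
         (trans (ℤP.pos-* 2 (2 ^ (v + d))) (cong (+ 2 *ℤ_) (pos-^-+ v d)))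
  factor : ∀ P D o → + 2 *ℤ (P *ℤ D) +ℤ P *ℤ o ≡ P *ℤ (o +ℤ + 2 *ℤ D)
  factor = solve-∀
  K+i≡ : + (2 ^ h + i) ≡ + (2 ^ v) *ℤ (o +ℤ + 2 *ℤ + (2 ^ d))
  K+i≡ = trans (ℤP.pos-+ (2 ^ h) i) (trans (cong₂ _+ℤ_ K≡ i≡) (factor (+ (2 ^ v)) (+ (2 ^ d)) o))

-- ν₂((K+m)!) = ν₂(K!) + ν₂(m!), since (K+m)!/K! = Π_{i ≤ m} (K+i).
val-fact-shift : ∀ h m {a b} → m < 2 ^ h → Val (+ ((2 ^ h) !)) a → Val (+ (m !)) b → Val (+ ((2 ^ h + m) !)) (a + b)
val-fact-shift h zero {a} {b} _ K!-val 1-val =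
  subst₂ (λ t u → Val (+ (t !)) u) (sym (ℕP.+-identityʳ (2 ^ h)))
    (trans (sym (ℕP.+-identityʳ a)) (cong (λ t → a + t) (val-unique (val-pow 0) 1-val))) K!-val
val-fact-shift h (suc m) {a} {b} m+1<K K!-val [m+1]!-val with val-exists-ℕ (suc m) (λ ()) | val-exists-ℕ (m !) (factorial≢0 m)
... | c , m+1-val | b′ , m!-val = subst₂ (λ t u → Val (+ (t !)) u) (sym (ℕP.+-suc (2 ^ h) m)) exponents product-val
  where
  K+m+1-val : Val (+ suc (2 ^ h + m)) c
  K+m+1-val = subst (λ t → Val (+ t) c) (ℕP.+-suc (2 ^ h) m) (val-+pow h (suc m) m+1<K m+1-val)
  product-val : Val (+ (suc (2 ^ h + m) !)) (c + (a + b′))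
  product-val = subst (λ t → Val t (c + (a + b′))) (sym (ℤP.pos-* (suc (2 ^ h + m)) ((2 ^ h + m) !)))
                  (val-* K+m+1-val (val-fact-shift h m (ℕP.<-trans (ℕP.n<1+n m) m+1<K) K!-val m!-val))
  b≡ : b ≡ c + b′
  b≡ = val-unique [m+1]!-val (subst (λ t → Val t (c + b′)) (sym (ℤP.pos-* (suc m) (m !))) (val-* m+1-val m!-val))
  rearrange : ∀ a b c → c + (a + b) ≡ a + (c + b)
  rearrange = ℕSolver.solve-∀
  exponents : c + (a + b′) ≡ a + b
  exponents = trans (rearrange a b′ c) (cong (λ t → a + t) (sym b≡))

-- For 0 < j+1 < K = 2^h:  if C(K−1, j) is odd then C(K, j+1) is even, since
-- (j+1)·C(K, j+1) = K·C(K−1, j) has valuation h while ν₂(j+1) < h.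
binomial-not-odd : ∀ h K′ → 2 ^ h ≡ suc K′ → ∀ j → suc j < suc K′ → Odd (+ (K′ C j)) → ¬ Odd (+ (suc K′ C suc j))
binomial-not-odd h K′ 2^h≡ j j+1<K C-odd C′-odd with val-exists-ℕ (suc j) (λ ())
... | v , j+1-val = ℕP.<-irrefl v≡h (exponent-< (val-≤ j+1-val) (subst (suc j <_) (sym 2^h≡) j+1<K))
  where
  lhs-val : Val (+ (suc j * (suc K′ C suc j))) (v + 0)
  lhs-val = subst (λ t → Val t (v + 0)) (sym (ℤP.pos-* (suc j) _)) (val-* j+1-val (odd→val C′-odd))
  rhs-val : Val (+ (suc K′ * (K′ C j))) (h + 0)
  rhs-val = subst (λ t → Val t (h + 0)) (sym (ℤP.pos-* (suc K′) _))
              (val-* (subst (λ t → Val (+ t) h) 2^h≡ (val-pow h)) (odd→val C-odd))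
  v≡h : v ≡ h
  v≡h = ℕP.+-cancelʳ-≡ 0 v h (val-unique (subst (λ t → Val (+ t) (v + 0)) (C-absorb K′ j) lhs-val) rhs-val)

-- All C(2^h − 1, j) with j ≤ 2^h − 1 are odd (Pascal's rule modulo 2).
binomial-odd : ∀ h K′ → 2 ^ h ≡ suc K′ → ∀ j → j ≤ K′ → Odd (+ (K′ C j))
binomial-odd h K′ 2^h≡ zero    _      = subst (λ t → Odd (+ t)) (sym (C-zeroʳ K′)) odd-one
binomial-odd h K′ 2^h≡ (suc j) j+1≤K′ with binomial-odd h K′ 2^h≡ j (ℕP.≤-trans (ℕP.n≤1+n j) j+1≤K′) | parity (suc K′ C suc j)
... | C-odd | inj₂ (q , C′≡odd) = ⊥-elim (binomial-not-odd h K′ 2^h≡ j (s≤s j+1≤K′) C-odd (odd-ℕ q C′≡odd))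
... | mkOdd k C≡ | inj₁ (q , C′≡even) = mkOdd (+ q -ℤ k -ℤ + 1) next≡
  where
  -- C(K′, j+1) = C(K, j+1) − C(K′, j) = even − odd
  sum≡ : + (K′ C j) +ℤ + (K′ C suc j) ≡ + 2 *ℤ + q
  sum≡ = trans (sym (ℤP.pos-+ (K′ C j) _)) (trans (cong +_ (trans (sym (C-pascal K′ j)) C′≡even))
                                                  (trans (ℤP.pos-* q 2) (ℤP.*-comm (+ q) (+ 2))))
  cancel : ∀ x y → y ≡ (x +ℤ y) -ℤ x
  cancel = solve-∀
  halve : ∀ q k → + 2 *ℤ q -ℤ (+ 1 +ℤ + 2 *ℤ k) ≡ + 1 +ℤ + 2 *ℤ (q -ℤ k -ℤ + 1)
  halve = solve-∀
  next≡ : + (K′ C suc j) ≡ + 1 +ℤ + 2 *ℤ (+ q -ℤ k -ℤ + 1)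
  next≡ = trans (cancel (+ (K′ C j)) _) (trans (cong₂ _-ℤ_ sum≡ C≡) (halve (+ q) k))

-- ν₂(m) + ν₂(C(2^h, m)) = h  for 0 < m < 2^h, from m·C(K, m) = K·C(K−1, m−1).
val-binomial : ∀ h m′ → suc m′ < 2 ^ h → ∀ {νm} → Val (+ suc m′) νm →
  Σ ℕ λ vb → Val (+ (2 ^ h C suc m′)) vb × (νm + vb ≡ h)
val-binomial h m′ m<K {νm} m-val with pow-pred h
... | K′ , 2^h≡ = vb , subst (λ t → Val (+ (t C suc m′)) vb) (sym 2^h≡) C-val ,
                  trans (val-unique lhs-val rhs-val) (ℕP.+-identityʳ h)
  where
  rhs-val : Val (+ (suc m′ * (suc K′ C suc m′))) (h + 0)
  rhs-val = subst (λ t → Val (+ t) (h + 0)) (sym (C-absorb K′ m′))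
              (subst (λ t → Val t (h + 0)) (sym (ℤP.pos-* (suc K′) _))
                (val-* (subst (λ t → Val (+ t) h) 2^h≡ (val-pow h))
                       (odd→val (binomial-odd h K′ 2^h≡ m′ (ℕP.<⇒≤ (ℕP.≤-pred (subst (suc m′ <_) 2^h≡ m<K)))))))
  C≢0 : + (suc K′ C suc m′) ≢ + 0
  C≢0 C≡0 = val-zero (subst (λ t → Val t (h + 0))
              (cong +_ (trans (cong (suc m′ *_) (ℤP.+-injective C≡0)) (ℕP.*-zeroʳ (suc m′)))) rhs-val)
  vb : ℕ
  vb = proj₁ (val-exists (+ (suc K′ C suc m′)) C≢0)
  C-val : Val (+ (suc K′ C suc m′)) vb
  C-val = proj₂ (val-exists (+ (suc K′ C suc m′)) C≢0)
  lhs-val : Val (+ (suc m′ * (suc K′ C suc m′))) (νm + vb)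
  lhs-val = subst (λ t → Val t (νm + vb)) (sym (ℤP.pos-* (suc m′) _)) (val-* m-val C-val)

-- Linear bookkeeping of valuations for n = 2^h + m, 0 < m < 2^h:  from
--   m + (ν₂(K!) + ν₂(s)) = ν₂(C(K,m)) + (ν₂(K!) + ν₂(m!))     (by (⋆))
--   ν₂(m!) + σ₂(m) = m,   σ₂(m) + ν₂(m) = σ₂(m−1) + 1,   ν₂(m) + ν₂(C(K,m)) = h
-- it follows that ν₂(s) + σ₂(m−1) + 1 = h.
valuation-bookkeeping : ∀ {m a vs vb b′ σm νm σm′ h} →
  m + (a + vs) ≡ vb + (a + b′) → b′ + σm ≡ m → σm + νm ≡ σm′ + 1 → νm + vb ≡ h → vs + suc σm′ ≡ h
valuation-bookkeeping {m} {a} {vs} {vb} {b′} {σm} {νm} {σm′} {h} stir≡ legendre-m carry-m binomial-m = begin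
    vs + suc σm′      ≡⟨ cong (λ t → vs + t) (trans (ℕP.+-comm 1 σm′) (sym carry-m)) ⟩
    vs + (σm + νm)    ≡⟨ shuffle vs σm νm ⟩
    (σm + vs) + νm    ≡⟨ cong (_+ νm) σm+vs≡vb ⟩
    vb + νm           ≡⟨ ℕP.+-comm vb νm ⟩
    νm + vb           ≡⟨ binomial-m ⟩
    h                 ∎
  where
  open ≡-Reasoning
  shuffle : ∀ vs σm νm → vs + (σm + νm) ≡ (σm + vs) + νm
  shuffle = ℕSolver.solve-∀
  regroup : ∀ a b′ σm vs → (a + b′) + (σm + vs) ≡ (b′ + σm) + (a + vs)
  regroup = ℕSolver.solve-∀
  σm+vs≡vb : σm + vs ≡ vb
  σm+vs≡vb = ℕP.+-cancelˡ-≡ (a + b′) (σm + vs) vb (begin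
    (a + b′) + (σm + vs)   ≡⟨ regroup a b′ σm vs ⟩
    (b′ + σm) + (a + vs)   ≡⟨ cong (_+ (a + vs)) legendre-m ⟩
    m + (a + vs)           ≡⟨ stir≡ ⟩
    vb + (a + b′)          ≡⟨ ℕP.+-comm vb (a + b′) ⟩
    (a + b′) + vb          ∎)

stirling-valuation : ∀ h m → m < 2 ^ h → Σ ℕ λ v → Val (s (2 ^ h + m) (2 ^ h)) v × (v + σ₂ (2 ^ h + m ∸ 1) ≡ h)
stirling-valuation h zero _ with pow-pred h
... | K′ , 2^h≡ = 0 , odd→val (subst Odd (sym s≡1) odd-one) , 
                  trans (cong (λ t → σ₂ (t ∸ 1)) (trans (ℕP.+-identityʳ (2 ^ h)) 2^h≡)) (σ-all-ones h K′ 2^h≡)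
  where
  s≡1 : s (2 ^ h + 0) (2 ^ h) ≡ + 1
  s≡1 = trans (cong (λ t → s t (2 ^ h)) (ℕP.+-identityʳ (2 ^ h))) (s-diag (2 ^ h))
stirling-valuation h (suc m′) m<K = vs , s-val , trans (cong (λ t → vs + t) σ-index)
    (valuation-bookkeeping {a = a} {vs = vs} {vb = vb} {b′ = b′} {νm = νm} stir-exponents (legendre m m!-val) (carry m′ m-val) νm+vb≡h)
  where
  K m : ℕ
  K = 2 ^ h
  m = suc m′
  νm a b′ : ℕ
  νm = proj₁ (val-exists-ℕ m (λ ()))
  a  = proj₁ (val-exists-ℕ (K !) (factorial≢0 K))
  b′ = proj₁ (val-exists-ℕ (m !) (factorial≢0 m))
  m-val : Val (+ m) νm
  m-val = proj₂ (val-exists-ℕ m (λ ()))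
  K!-val : Val (+ (K !)) a
  K!-val = proj₂ (val-exists-ℕ (K !) (factorial≢0 K))
  m!-val : Val (+ (m !)) b′
  m!-val = proj₂ (val-exists-ℕ (m !) (factorial≢0 m))
  vb : ℕ
  vb = proj₁ (val-binomial h m′ m<K m-val)
  C-val : Val (+ (K C m)) vb
  C-val = proj₁ (proj₂ (val-binomial h m′ m<K m-val))
  νm+vb≡h : νm + vb ≡ h
  νm+vb≡h = proj₂ (proj₂ (val-binomial h m′ m<K m-val))
  -- (⋆) at i = m, where ν₂(C(K,m)) ≤ h.
  stir-val : Val (stir K m) (vb + (a + b′))
  stir-val = val-from-congruence (congruence h m) C-val (val-fact-shift h m m<K K!-val m!-val)
               (subst (vb ≤_) νm+vb≡h (ℕP.m≤n+m vb νm))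
  s≢0 : s (K + m) K ≢ + 0
  s≢0 s≡0 = val-zero (subst (λ t → Val t (vb + (a + b′)))
              (trans (cong (λ t → + (2 ^ m) *ℤ (+ (K !) *ℤ t)) s≡0)
                     (trans (cong (+ (2 ^ m) *ℤ_) (ℤP.*-zeroʳ (+ (K !)))) (ℤP.*-zeroʳ (+ (2 ^ m))))) stir-val)
  vs : ℕ
  vs = proj₁ (val-exists (s (K + m) K) s≢0)
  s-val : Val (s (K + m) K) vs
  s-val = proj₂ (val-exists (s (K + m) K) s≢0)
  stir-exponents : m + (a + vs) ≡ vb + (a + b′)
  stir-exponents = val-unique (val-* (val-pow m) (val-* K!-val s-val)) stir-val
  σ-index : σ₂ (K + m ∸ 1) ≡ suc (σ₂ m′)
  σ-index = trans (cong (λ t → σ₂ (t ∸ 1)) (ℕP.+-suc K m′)) (σ-leading-one h m′ (ℕP.<-trans (ℕP.n<1+n m′) m<K))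

ν₂-from-sum : ∀ {z v σ h} → Val z v → v + σ ≡ h → (σ ≤ h) × ν₂≡ z (h ∸ σ)
ν₂-from-sum {z} {v} {σ} z-val v+σ≡h =
  subst (σ ≤_) v+σ≡h (ℕP.m≤n+m σ v) ,
  subst (ν₂≡ z) (sym (trans (cong (_∸ σ) (sym v+σ≡h)) (ℕP.m+n∸n≡m v σ))) (val→ν₂ z-val)

corollary3p3 : (h n : ℕ) → 2 ^ h ≤ n → n < 2 ^ suc h →
    (σ₂ (n ∸ 1) ≤ h) × ν₂≡ (stirling1 n (2 ^ h)) (h ∸ σ₂ (n ∸ 1))
corollary3p3 h n 2^h≤n n<2^[1+h] = ν₂-from-sum (proj₁ (proj₂ valuation)) (proj₂ (proj₂ valuation))
  where
  m : ℕ
  m = n ∸ 2 ^ h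
  n≡ : 2 ^ h + m ≡ n
  n≡ = ℕP.m+[n∸m]≡n 2^h≤n
  m<2^h : m < 2 ^ h
  m<2^h = ℕP.+-cancelˡ-< (2 ^ h) m (2 ^ h)
            (subst₂ _<_ (sym n≡) (cong (λ t → 2 ^ h + t) (ℕP.+-identityʳ (2 ^ h))) n<2^[1+h])
  valuation : Σ ℕ λ v → Val (s n (2 ^ h)) v × (v + σ₂ (n ∸ 1) ≡ h)
  valuation = subst (λ t → Σ ℕ λ v → Val (s t (2 ^ h)) v × (v + σ₂ (t ∸ 1) ≡ h)) n≡ (stirling-valuation h m m<2^h)
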